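{- A graph belongs to the lower $\{C_4,\text{diamond}\}$-free switching class if and only if it is isomorphic to a graph of one of the forms $(+)$, $(+,0,+)$, $(1,1,1)$, $(1,0,1,0,1)$.
   Context: All graphs are finite and simple. For a graph $G$ and $A\subseteq V(G)$, the switching $S(G,A)$ is the graph on $V(G)$ whose edges are the edges of $G$ with both ends in $A$, the edges of $G$ with both ends outside $A$, and all pairs $uv$ with $u\in A$, $v\notin A$, $uv\notin E(G)$. The lower $\{C_4,\text{diamond}\}$-free switching class consists of graphs $G$ such that for every $A\subseteq V(G)$, $S(G,A)$ has no induced 4-cycle and no induced diamond ($K_4$ minus an edge). Notation: for nonnegative integers $a_1,\ldots,a_p$, $(a_1,\ldots,a_p)$ denotes the graph obtained from the path $v_1\cdots v_p$ by replacing each $v_i$ with a clique $Q_i$ of $a_i$ vertices, with $Q_i,Q_j$ complete to each other if $|i-j|=1$ and no edges between them otherwise (a $0$ entry means that position is empty). A symbol $+$ stands for an arbitrary positive integer, each occurrence chosen independently. -}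

module Defs where

open import Data.Nat using (ℕ; zero; suc; _+_; _≤ᵇ_; ∣_-_∣)
open import Data.Bool using (Bool; true; false; not; _∧_; if_then_else_)
open import Data.Bool.Properties using () renaming (_≟_ to _≟B_)
open import Data.Fin using (Fin; toℕ; splitAt)
open import Data.List using (List; []; _∷_)
open import Data.Nat.ListAction using (sum)
open import Data.Sum using (inj₁; inj₂)
open import Data.Product using (Σ; _×_; _,_; ∃)
open import Relation.Binary.PropositionalEquality using (_≡_; _≢_)
open import Relation.Nullary using (¬_)
open import Relation.Nullary.Decidable using (⌊_⌋)
open import Function.Bundles using (_↔_; Inverse)

record Graph : Set where
  field
    n      : ℕ
    adj    : Fin n → Fin n → Bool
    sym    : ∀ u v → adj u v ≡ adj v u
    irrefl : ∀ u → adj u u ≡ false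
open Graph public

switchAdj : (G : Graph) → (Fin (n G) → Bool) → Fin (n G) → Fin (n G) → Bool
switchAdj G A u v =
  if ⌊ A u ≟B A v ⌋ then adj G u v else not (adj G u v)

Edge : {m : ℕ} → (Fin m → Fin m → Bool) → Fin m → Fin m → Set
Edge E u v = E u v ≡ true

NonEdge : {m : ℕ} → (Fin m → Fin m → Bool) → Fin m → Fin m → Set
NonEdge E u v = E u v ≡ false

Distinct4 : {m : ℕ} → Fin m → Fin m → Fin m → Fin m → Set
Distinct4 a b c d =
  a ≢ b × a ≢ c × a ≢ d × b ≢ c × b ≢ d × c ≢ d

HasInducedC4 : {m : ℕ} → (Fin m → Fin m → Bool) → Set
HasInducedC4 {m} E = Σ (Fin m) λ a → Σ (Fin m) λ b → Σ (Fin m) λ c → Σ (Fin m) λ d →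
  Distinct4 a b c d ×
  Edge E a b × Edge E b c × Edge E c d × Edge E d a ×
  NonEdge E a c × NonEdge E b d

HasInducedDiamond : {m : ℕ} → (Fin m → Fin m → Bool) → Set
HasInducedDiamond {m} E = Σ (Fin m) λ a → Σ (Fin m) λ b → Σ (Fin m) λ c → Σ (Fin m) λ d →
  Distinct4 a b c d ×
  Edge E a b × Edge E a d × Edge E b c × Edge E c d × Edge E b d ×
  NonEdge E a c

InLowerC4DiamondFreeSwitchingClass : Graph → Set
InLowerC4DiamondFreeSwitchingClass G =
  (A : Fin (n G) → Bool) →
    ¬ HasInducedC4 (switchAdj G A) × ¬ HasInducedDiamond (switchAdj G A)

-- The graph (a_1,...,a_p): vertex set Fin (a_1 + ... + a_p), the first a_1
-- vertices form Q_1, the next a_2 form Q_2, etc.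
blockOf : (as : List ℕ) → Fin (sum as) → ℕ
blockOf []       ()
blockOf (a ∷ as) x with splitAt a x
... | inj₁ _ = zero
... | inj₂ y = suc (blockOf as y)

blowupAdj : (as : List ℕ) → Fin (sum as) → Fin (sum as) → Bool
blowupAdj as u v =
  not ⌊ toℕ u Data.Nat.≟ toℕ v ⌋ ∧ (∣ blockOf as u - blockOf as v ∣ ≤ᵇ 1)

IsoTo : (G : Graph) → {m : ℕ} → (Fin m → Fin m → Bool) → Set
IsoTo G {m} E = Σ (Fin (n G) ↔ Fin m) λ f →
  ∀ u v → adj G u v ≡ E (Inverse.to f u) (Inverse.to f v)

IsoToBlowup : Graph → List ℕ → Set
IsoToBlowup G as = IsoTo G {sum as} (blowupAdj as)

{-# OPTIONS --safe #-}
-- The parity of the number of edges of a triangle is invariant under switching,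
-- and the 4-cycle and the diamond both contain an even triangle (an induced path
-- on three vertices); so graphs all of whose triangles are odd lie in the class.
-- Conversely, let the triangle uvw be even and d a fourth vertex. Switching at the
-- closed neighbourhood of d makes d adjacent to u, v, w; then uvw has two edges
-- and d completes a diamond, or it has none and a further switch at u produces the
-- 4-cycle u v d w. Hence, unless there are exactly three vertices, the class
-- consists of the graphs with only odd triangles, and these are exactly the
-- disjoint unions of at most two cliques: the closed neighbourhood of any vertex
-- and its complement. On three vertices nothing is forbidden, and the four graphs
-- there are (3), (2,0,1), (1,1,1) and (1,0,1,0,1).

module Submission where

open import Defs hiding (sym)
open import Data.Nat using (ℕ; _≥_; _<_)
open import Data.List using (List; []; _∷_)
open import Data.Sum using (_⊎_)
open import Data.Product using (Σ; _×_)
open import Function.Bundles using (_⇔_)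

open import Data.Nat using (zero; suc; _+_; _≤_; z≤n; s≤s; _≤ᵇ_; ∣_-_∣)
open import Data.Nat.Properties using (+-identityʳ; ∣-∣-comm; ≤-trans; 1+n≰n) renaming (_≟_ to _≟ℕ_)
open import Data.Nat.ListAction using (sum)
open import Data.Bool using (Bool; true; false; not; _xor_; _∨_; _∧_; if_then_else_)
open import Data.Bool.Properties using (xor-comm; xor-identityʳ; xor-inverseʳ; xor-same; not-involutive; ¬-not)
  renaming (_≟_ to _≟B_)
open import Data.Bool.Solver using (module xor-∧-Solver)
open import Data.Fin using (Fin; zero; suc; toℕ; splitAt; fromℕ<; _≟_)
open import Data.Fin.Patterns using (0F; 1F; 2F)
open import Data.Fin.Properties using (toℕ-injective; splitAt-join; +↔⊎; any?; injective⇒≤; cantor-schröder-bernstein)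
open import Data.Fin.Permutation using (transpose; cast-id)
import Data.Fin.Permutation as Permutation
open import Data.Vec.Functional using (Vector) renaming (_∷_ to _∷ᵛ_; [] to []ᵛ)
open import Data.Sum using (inj₁; inj₂; map)
open import Data.Sum.Algebra using (⊎-assoc; ⊎-comm; ⊎-cong)
open import Data.Product using (_,_; proj₁; proj₂; ∃)
open import Data.Empty using (⊥)
open import Function.Base using (_∘_; const)
open import Function.Bundles using (_↔_; Inverse; Injection; mk⇔)
open import Function.Definitions using (Injective)
open import Function.Properties.Inverse using (↔-refl; ↔-sym; ↔-trans; Inverse⇒Injection)
open import Relation.Binary.PropositionalEquality using (_≡_; _≢_; refl; sym; trans; cong; cong₂; ≢-sym; module ≡-Reasoning)
open import Relation.Nullary using (¬_; Dec; yes; no; contradiction)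
open import Relation.Nullary.Decidable using (⌊_⌋; ¬?; _×-dec_; dec-true; dec-false; isYes≗does)

open ≡-Reasoning
open Inverse using (to)

private
  variable
    m k : ℕ

if-≟-xor : ∀ p q e → (if ⌊ p ≟B q ⌋ then e else not e) ≡ e xor (p xor q)
if-≟-xor true  true  e = sym (xor-identityʳ e)
if-≟-xor true  false e = sym (xor-comm e true)
if-≟-xor false true  e = sym (xor-comm e true)
if-≟-xor false false e = sym (xor-identityʳ e)

xor-regroup : ∀ e a b c d → (e xor (a xor b)) xor (c xor d) ≡ e xor ((a xor c) xor (b xor d))
xor-regroup = solve 5 (λ e a b c d → (e :+ (a :+ b)) :+ (c :+ d) := e :+ ((a :+ c) :+ (b :+ d))) refl
  where open xor-∧-Solver

xor-triangle : ∀ e₁ e₂ e₃ p q r →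
  (e₁ xor (p xor q)) xor ((e₂ xor (q xor r)) xor (e₃ xor (p xor r))) ≡ e₁ xor (e₂ xor e₃)
xor-triangle = solve 6 (λ e₁ e₂ e₃ p q r →
  (e₁ :+ (p :+ q)) :+ ((e₂ :+ (q :+ r)) :+ (e₃ :+ (p :+ r))) := e₁ :+ (e₂ :+ e₃)) refl
  where open xor-∧-Solver

same-side-parity : ∀ p q r → not (p xor q) xor (not (q xor r) xor not (p xor r)) ≡ true
same-side-parity true  true  true  = refl
same-side-parity true  true  false = refl
same-side-parity true  false true  = refl
same-side-parity true  false false = refl
same-side-parity false true  true  = refl
same-side-parity false true  false = refl
same-side-parity false false true  = refl
same-side-parity false false false = refl

odd-parity-middle : ∀ p e q → p xor (e xor q) ≡ true → e ≡ not (p xor q)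
odd-parity-middle true  true  true  _ = refl
odd-parity-middle true  false false _ = refl
odd-parity-middle false true  false _ = refl
odd-parity-middle false false true  _ = refl

isYes-true : {A : Set} (a? : Dec A) → A → ⌊ a? ⌋ ≡ true
isYes-true a? a = trans (isYes≗does a?) (dec-true a? a)

isYes-false : {A : Set} (a? : Dec A) → ¬ A → ⌊ a? ⌋ ≡ false
isYes-false a? ¬a = trans (isYes≗does a?) (dec-false a? ¬a)

to-injective : {A B : Set} (f : A ↔ B) → Injective _≡_ _≡_ (to f)
to-injective f = Injection.injective (Inverse⇒Injection f)

∷-injective : ∀ {d : Fin m} {f : Vector (Fin m) k} → Injective _≡_ _≡_ f → (∀ i → d ≢ f i) →
              Injective _≡_ _≡_ (d ∷ᵛ f)
∷-injective _     _   {zero}  {zero}  _  = refl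
∷-injective _     d∉f {zero}  {suc j} eq = contradiction eq (d∉f j)
∷-injective _     d∉f {suc i} {zero}  eq = contradiction (sym eq) (d∉f i)
∷-injective f-inj _   {suc i} {suc j} eq = cong suc (f-inj eq)

distinct₃-injective : {x y z : Fin m} → x ≢ y → x ≢ z → y ≢ z →
                      Injective _≡_ _≡_ (x ∷ᵛ y ∷ᵛ z ∷ᵛ []ᵛ)
distinct₃-injective x≢y x≢z y≢z =
  ∷-injective (∷-injective (∷-injective (λ {}) λ ()) λ { 0F → y≢z ; (suc ()) })
    λ { 0F → x≢y ; 1F → x≢z ; (suc (suc ())) }

distinct₄-injective : {a b c d : Fin m} → Distinct4 a b c d →
                      Injective _≡_ _≡_ (a ∷ᵛ b ∷ᵛ c ∷ᵛ d ∷ᵛ []ᵛ)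
distinct₄-injective (a≢b , a≢c , a≢d , b≢c , b≢d , c≢d) =
  ∷-injective (∷-injective (∷-injective (∷-injective (λ {}) λ ()) λ { 0F → c≢d ; (suc ()) })
    λ { 0F → b≢c ; 1F → b≢d ; (suc (suc ())) })
    λ { 0F → a≢b ; 1F → a≢c ; 2F → a≢d ; (suc (suc (suc ()))) }

vertex-outside-triple : {x y z : Fin m} → m ≢ 3 → x ≢ y → x ≢ z → y ≢ z →
                        ∃ λ d → x ≢ d × y ≢ d × z ≢ d
vertex-outside-triple {m} {x} {y} {z} m≢3 x≢y x≢z y≢z
  with any? (λ d → ¬? (x ≟ d) ×-dec ¬? (y ≟ d) ×-dec ¬? (z ≟ d))
... | yes outside = outside
... | no  none    = contradiction
  (cantor-schröder-bernstein (distinct₃-injective x≢y x≢z y≢z) index-injective) (m≢3 ∘ sym)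
  where
  triple : Vector (Fin m) 3
  triple = x ∷ᵛ y ∷ᵛ z ∷ᵛ []ᵛ

  index : ∀ d → ∃ λ i → triple i ≡ d
  index d with x ≟ d | y ≟ d | z ≟ d
  ... | yes x≡d | _       | _       = 0F , x≡d
  ... | no _    | yes y≡d | _       = 1F , y≡d
  ... | no _    | no _    | yes z≡d = 2F , z≡d
  ... | no x≢d  | no y≢d  | no z≢d  = contradiction (d , x≢d , y≢d , z≢d) none

  index-injective : Injective _≡_ _≡_ (proj₁ ∘ index)
  index-injective {d} {d′} eq =
    trans (sym (proj₂ (index d))) (trans (cong triple eq) (proj₂ (index d′)))

switchAdj-xor : ∀ G A x y → switchAdj G A x y ≡ adj G x y xor (A x xor A y)
switchAdj-xor G A x y = if-≟-xor (A x) (A y) (adj G x y)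

switch : (G : Graph) → (Fin (n G) → Bool) → Graph
switch G A = record
  { n      = n G
  ; adj    = switchAdj G A
  ; sym    = switch-sym
  ; irrefl = λ x → trans (switchAdj-xor G A x x) (cong₂ _xor_ (irrefl G x) (xor-same (A x)))
  }
  where
  switch-sym : ∀ x y → switchAdj G A x y ≡ switchAdj G A y x
  switch-sym x y = begin
    switchAdj G A x y            ≡⟨ switchAdj-xor G A x y ⟩
    adj G x y xor (A x xor A y)  ≡⟨ cong₂ _xor_ (Graph.sym G x y) (xor-comm (A x) (A y)) ⟩
    adj G y x xor (A y xor A x)  ≡⟨ switchAdj-xor G A y x ⟨
    switchAdj G A y x            ∎

switchAdj-switch : ∀ G A B x y → switchAdj (switch G A) B x y ≡ switchAdj G (λ z → A z xor B z) x y
switchAdj-switch G A B x y = begin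
  switchAdj (switch G A) B x y                      ≡⟨ switchAdj-xor (switch G A) B x y ⟩
  switchAdj G A x y xor (B x xor B y)               ≡⟨ cong (_xor (B x xor B y)) (switchAdj-xor G A x y) ⟩
  (adj G x y xor (A x xor A y)) xor (B x xor B y)   ≡⟨ xor-regroup (adj G x y) (A x) (A y) (B x) (B y) ⟩
  adj G x y xor ((A x xor B x) xor (A y xor B y))   ≡⟨ switchAdj-xor G (λ z → A z xor B z) x y ⟨
  switchAdj G (λ z → A z xor B z) x y               ∎

HasInducedC4-cong : {E F : Fin m → Fin m → Bool} → (∀ x y → E x y ≡ F x y) → HasInducedC4 E → HasInducedC4 F
HasInducedC4-cong {E = E} {F} E≗F (a , b , c , d , ds , ab , bc , cd , da , ac , bd) =
  a , b , c , d , ds , move ab , move bc , move cd , move da , move ac , move bd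
  where
  move : ∀ {x y β} → E x y ≡ β → F x y ≡ β
  move {x} {y} = trans (sym (E≗F x y))

HasInducedDiamond-cong : {E F : Fin m → Fin m → Bool} → (∀ x y → E x y ≡ F x y) →
                         HasInducedDiamond E → HasInducedDiamond F
HasInducedDiamond-cong {E = E} {F} E≗F (a , b , c , d , ds , ab , ad , bc , cd , bd , ac) =
  a , b , c , d , ds , move ab , move ad , move bc , move cd , move bd , move ac
  where
  move : ∀ {x y β} → E x y ≡ β → F x y ≡ β
  move {x} {y} = trans (sym (E≗F x y))

switch-preserves-class : ∀ G A → InLowerC4DiamondFreeSwitchingClass G →
                         InLowerC4DiamondFreeSwitchingClass (switch G A)
switch-preserves-class G A inClass B with inClass (λ z → A z xor B z)
... | noC4 , noDiamond =
  noC4 ∘ HasInducedC4-cong (switchAdj-switch G A B) , noDiamond ∘ HasInducedDiamond-cong (switchAdj-switch G A B)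

-- Parity of triangles

triangleParity : (Fin m → Fin m → Bool) → Fin m → Fin m → Fin m → Bool
triangleParity E x y z = E x y xor (E y z xor E x z)

OddTriangles : (Fin m → Fin m → Bool) → Set
OddTriangles {m} E = (x y z : Fin m) → x ≢ y → x ≢ z → y ≢ z → triangleParity E x y z ≡ true

triangleParity-switch : ∀ G A x y z → triangleParity (switchAdj G A) x y z ≡ triangleParity (adj G) x y z
triangleParity-switch G A x y z = begin
  triangleParity (switchAdj G A) x y z
    ≡⟨ cong₂ _xor_ (switchAdj-xor G A x y) (cong₂ _xor_ (switchAdj-xor G A y z) (switchAdj-xor G A x z)) ⟩
  (adj G x y xor (A x xor A y)) xor ((adj G y z xor (A y xor A z)) xor (adj G x z xor (A x xor A z)))
    ≡⟨ xor-triangle (adj G x y) (adj G y z) (adj G x z) (A x) (A y) (A z) ⟩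
  triangleParity (adj G) x y z ∎

inducedP₃-even : {E : Fin m → Fin m → Bool} {a b c : Fin m} →
                 Edge E a b → Edge E b c → NonEdge E a c → triangleParity E a b c ≡ false
inducedP₃-even ab bc ac = cong₂ _xor_ ab (cong₂ _xor_ bc ac)

oddTriangles⇒inClass : ∀ G → OddTriangles (adj G) → InLowerC4DiamondFreeSwitchingClass G
oddTriangles⇒inClass G odd A =
  (λ { (a , b , c , _ , (a≢b , a≢c , _ , b≢c , _) , ab , bc , _ , _ , ac , _) → no-induced-P₃ a≢b a≢c b≢c ab bc ac })
  , (λ { (a , b , c , _ , (a≢b , a≢c , _ , b≢c , _) , ab , _ , bc , _ , _ , ac) → no-induced-P₃ a≢b a≢c b≢c ab bc ac })
  where
  no-induced-P₃ : ∀ {a b c} → a ≢ b → a ≢ c → b ≢ c →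
                  Edge (switchAdj G A) a b → Edge (switchAdj G A) b c → NonEdge (switchAdj G A) a c → ⊥
  no-induced-P₃ {a} {b} {c} a≢b a≢c b≢c ab bc ac = contradiction (begin
    false                                ≡⟨ inducedP₃-even {E = switchAdj G A} ab bc ac ⟨
    triangleParity (switchAdj G A) a b c ≡⟨ triangleParity-switch G A a b c ⟩
    triangleParity (adj G) a b c         ≡⟨ odd a b c a≢b a≢c b≢c ⟩
    true                                 ∎) λ ()

-- Four vertices around an even triangle

closedNeighbourhood : (G : Graph) → Fin (n G) → Fin (n G) → Bool
closedNeighbourhood G d x = ⌊ x ≟ d ⌋ ∨ adj G d x

closedNeighbourhood-self : ∀ G d → closedNeighbourhood G d d ≡ true
closedNeighbourhood-self G d = cong (_∨ adj G d d) (isYes-true (d ≟ d) refl)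

closedNeighbourhood-≢ : ∀ G {d x} → x ≢ d → closedNeighbourhood G d x ≡ adj G d x
closedNeighbourhood-≢ G {d} {x} x≢d = cong (_∨ adj G d x) (isYes-false (x ≟ d) x≢d)

switch-closedNeighbourhood : ∀ G {d x} → x ≢ d → adj (switch G (closedNeighbourhood G d)) d x ≡ true
switch-closedNeighbourhood G {d} {x} x≢d = begin
  switchAdj G N[d] d x                ≡⟨ switchAdj-xor G N[d] d x ⟩
  adj G d x xor (N[d] d xor N[d] x)   ≡⟨ cong₂ (λ p q → adj G d x xor (p xor q))
                                               (closedNeighbourhood-self G d) (closedNeighbourhood-≢ G x≢d) ⟩
  adj G d x xor not (adj G d x)       ≡⟨ xor-inverseʳ (adj G d x) ⟩
  true                                ∎
  where
  N[d] : Fin (n G) → Bool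
  N[d] = closedNeighbourhood G d

singleton : Fin m → Fin m → Bool
singleton u x = ⌊ x ≟ u ⌋

switch-singleton-at : ∀ G {u y} → y ≢ u → adj (switch G (singleton u)) u y ≡ not (adj G u y)
switch-singleton-at G {u} {y} y≢u = begin
  switchAdj G (singleton u) u y           ≡⟨ switchAdj-xor G (singleton u) u y ⟩
  adj G u y xor (⌊ u ≟ u ⌋ xor ⌊ y ≟ u ⌋) ≡⟨ cong₂ (λ p q → adj G u y xor (p xor q))
                                                    (isYes-true (u ≟ u) refl) (isYes-false (y ≟ u) y≢u) ⟩
  adj G u y xor true                      ≡⟨ xor-comm (adj G u y) true ⟩
  not (adj G u y)                         ∎

switch-singleton-away : ∀ G {u x y} → x ≢ u → y ≢ u → adj (switch G (singleton u)) x y ≡ adj G x y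
switch-singleton-away G {u} {x} {y} x≢u y≢u = begin
  switchAdj G (singleton u) x y           ≡⟨ switchAdj-xor G (singleton u) x y ⟩
  adj G x y xor (⌊ x ≟ u ⌋ xor ⌊ y ≟ u ⌋) ≡⟨ cong₂ (λ p q → adj G x y xor (p xor q))
                                                    (isYes-false (x ≟ u) x≢u) (isYes-false (y ≟ u) y≢u) ⟩
  adj G x y xor false                     ≡⟨ xor-identityʳ (adj G x y) ⟩
  adj G x y                               ∎

module _ (H : Graph) where

  private
    adj-flip : ∀ {x y β} → adj H x y ≡ β → adj H y x ≡ β
    adj-flip {x} {y} = trans (Graph.sym H y x)

  apex-diamond : ∀ {a b c d} → Distinct4 a b c d → Edge (adj H) a b → Edge (adj H) b c → NonEdge (adj H) a c →
                 Edge (adj H) d a → Edge (adj H) d b → Edge (adj H) d c → HasInducedDiamond (adj H)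
  apex-diamond ds ab bc ac da db dc = _ , _ , _ , _ , ds , ab , adj-flip da , bc , adj-flip dc , adj-flip db , ac

  evenTriangle-under-apex : ∀ {u v w d} → InLowerC4DiamondFreeSwitchingClass H → Distinct4 u v w d →
                            Edge (adj H) d u → Edge (adj H) d v → Edge (adj H) d w →
                            triangleParity (adj H) u v w ≡ false → ⊥
  evenTriangle-under-apex {u} {v} {w} {d} inClass ds@(u≢v , u≢w , u≢d , v≢w , v≢d , w≢d) du dv dw even
    with adj H u v in uv | adj H v w in vw | adj H u w in uw
  -- Two edges: d completes a diamond. No edge: switching at u turns the claw at d into the 4-cycle u v d w.
  ... | true  | true  | false = proj₂ (inClass (const false)) (apex-diamond ds uv vw uw du dv dw)
  ... | true  | false | true  = proj₂ (inClass (const false))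
    (apex-diamond (≢-sym u≢v , v≢w , v≢d , u≢w , u≢d , w≢d) (adj-flip uv) uw vw dv du dw)
  ... | false | true  | true  = proj₂ (inClass (const false))
    (apex-diamond (u≢w , u≢v , u≢d , ≢-sym v≢w , w≢d , v≢d) uw (adj-flip vw) uv du dw dv)
  ... | false | false | false = proj₁ (inClass (singleton u))
    ( u , v , d , w , (u≢v , u≢d , u≢w , v≢d , v≢w , ≢-sym w≢d)
    , trans (switch-singleton-at H (≢-sym u≢v)) (cong not uv)
    , trans (switch-singleton-away H (≢-sym u≢v) (≢-sym u≢d)) (adj-flip dv)
    , trans (switch-singleton-away H (≢-sym u≢d) (≢-sym u≢w)) dw
    , trans (Graph.sym (switch H (singleton u)) w u) (trans (switch-singleton-at H (≢-sym u≢w)) (cong not uw))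
    , trans (switch-singleton-at H (≢-sym u≢d)) (cong not (adj-flip du))
    , trans (switch-singleton-away H (≢-sym u≢v) (≢-sym u≢w)) vw )

evenTriangle⇒notInClass : ∀ G {u v w d} → InLowerC4DiamondFreeSwitchingClass G → Distinct4 u v w d →
                          triangleParity (adj G) u v w ≡ false → ⊥
evenTriangle⇒notInClass G {u} {v} {w} {d} inClass ds@(_ , _ , u≢d , _ , v≢d , w≢d) even =
  evenTriangle-under-apex (switch G N[d]) (switch-preserves-class G N[d] inClass) ds
    (switch-closedNeighbourhood G u≢d) (switch-closedNeighbourhood G v≢d) (switch-closedNeighbourhood G w≢d)
    (trans (triangleParity-switch G N[d] u v w) even)
  where
  N[d] : Fin (n G) → Bool
  N[d] = closedNeighbourhood G d

inClass⇒oddTriangles : ∀ G → n G ≢ 3 → InLowerC4DiamondFreeSwitchingClass G → OddTriangles (adj G)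
inClass⇒oddTriangles G n≢3 inClass x y z x≢y x≢z y≢z with vertex-outside-triple n≢3 x≢y x≢z y≢z
... | d , x≢d , y≢d , z≢d = ¬-not (evenTriangle⇒notInClass G inClass (x≢y , x≢z , x≢d , y≢z , y≢d , z≢d))

-- Disjoint unions of two cliques

TwoCliquesBy : (Fin m → Fin m → Bool) → (Fin m → Bool) → Set
TwoCliquesBy {m} E side = (x y : Fin m) → x ≢ y → E x y ≡ not (side x xor side y)

twoCliques⇒oddTriangles : ∀ {E : Fin m → Fin m → Bool} {side} → TwoCliquesBy E side → OddTriangles E
twoCliques⇒oddTriangles {side = side} twoCliques x y z x≢y x≢z y≢z =
  trans (cong₂ _xor_ (twoCliques x y x≢y) (cong₂ _xor_ (twoCliques y z y≢z) (twoCliques x z x≢z)))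
        (same-side-parity (side x) (side y) (side z))

oddTriangles⇒twoCliques : ∀ G → OddTriangles (adj G) → (z : Fin (n G)) →
                          TwoCliquesBy (adj G) (closedNeighbourhood G z)
oddTriangles⇒twoCliques G odd z x y x≢y with x ≟ z | y ≟ z
... | yes refl | yes refl = contradiction refl x≢y
... | yes refl | no _     = sym (not-involutive (adj G z y))
... | no _     | yes refl = begin
  adj G x z                     ≡⟨ Graph.sym G x z ⟩
  adj G z x                     ≡⟨ not-involutive (adj G z x) ⟨
  not (not (adj G z x))         ≡⟨ cong not (xor-comm (adj G z x) true) ⟨
  not (adj G z x xor true)      ∎
... | no x≢z   | no y≢z   =
  odd-parity-middle (adj G z x) (adj G x y) (adj G z y) (odd z x y (≢-sym x≢z) (≢-sym y≢z) x≢y)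

isLeft : {A B : Set} → A ⊎ B → Bool
isLeft (inj₁ _) = true
isLeft (inj₂ _) = false

blowupAdj-≢ : ∀ as {x y} → x ≢ y → blowupAdj as x y ≡ (∣ blockOf as x - blockOf as y ∣ ≤ᵇ 1)
blowupAdj-≢ as {x} {y} x≢y =
  cong (λ b → not b ∧ (∣ blockOf as x - blockOf as y ∣ ≤ᵇ 1)) (isYes-false (toℕ x ≟ℕ toℕ y) (x≢y ∘ toℕ-injective))

blowupAdj-irrefl : ∀ as x → blowupAdj as x x ≡ false
blowupAdj-irrefl as x =
  cong (λ b → not b ∧ (∣ blockOf as x - blockOf as x ∣ ≤ᵇ 1)) (isYes-true (toℕ x ≟ℕ toℕ x) refl)

blowupAdj-sym : ∀ as x y → blowupAdj as x y ≡ blowupAdj as y x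
blowupAdj-sym as x y with x ≟ y
... | yes refl = refl
... | no x≢y   = begin
  blowupAdj as x y                             ≡⟨ blowupAdj-≢ as x≢y ⟩
  ∣ blockOf as x - blockOf as y ∣ ≤ᵇ 1         ≡⟨ cong (_≤ᵇ 1) (∣-∣-comm (blockOf as x) (blockOf as y)) ⟩
  ∣ blockOf as y - blockOf as x ∣ ≤ᵇ 1         ≡⟨ blowupAdj-≢ as (≢-sym x≢y) ⟨
  blowupAdj as y x                             ∎

blockOf-singleton : ∀ a (x : Fin (a + 0)) → blockOf (a ∷ []) x ≡ 0
blockOf-singleton a x with splitAt a x
... | inj₁ _ = refl

blockOf-gapped : ∀ a b (x : Fin (sum (a ∷ 0 ∷ b ∷ []))) →
                 blockOf (a ∷ 0 ∷ b ∷ []) x ≡ (if isLeft (splitAt a x) then 0 else 2)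
blockOf-gapped a b x with splitAt a x
... | inj₁ _ = refl
... | inj₂ y = cong (2 +_) (blockOf-singleton b y)

blowup-clique : ∀ a → TwoCliquesBy (blowupAdj (a ∷ [])) (const true)
blowup-clique a x y x≢y = trans (blowupAdj-≢ (a ∷ []) x≢y)
  (cong₂ (λ i j → ∣ i - j ∣ ≤ᵇ 1) (blockOf-singleton a x) (blockOf-singleton a y))

blowup-twoCliques : ∀ a b → TwoCliquesBy (blowupAdj (a ∷ 0 ∷ b ∷ [])) (isLeft ∘ splitAt a)
blowup-twoCliques a b x y x≢y = begin
  blowupAdj (a ∷ 0 ∷ b ∷ []) x y
    ≡⟨ blowupAdj-≢ (a ∷ 0 ∷ b ∷ []) x≢y ⟩
  ∣ blockOf (a ∷ 0 ∷ b ∷ []) x - blockOf (a ∷ 0 ∷ b ∷ []) y ∣ ≤ᵇ 1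
    ≡⟨ cong₂ (λ i j → ∣ i - j ∣ ≤ᵇ 1) (blockOf-gapped a b x) (blockOf-gapped a b y) ⟩
  ∣ block (isLeft (splitAt a x)) - block (isLeft (splitAt a y)) ∣ ≤ᵇ 1
    ≡⟨ blocks-adjacent (isLeft (splitAt a x)) (isLeft (splitAt a y)) ⟩
  not (isLeft (splitAt a x) xor isLeft (splitAt a y)) ∎
  where
  block : Bool → ℕ
  block p = if p then 0 else 2

  blocks-adjacent : ∀ p q → (∣ block p - block q ∣ ≤ᵇ 1) ≡ not (p xor q)
  blocks-adjacent true  true  = refl
  blocks-adjacent true  false = refl
  blocks-adjacent false true  = refl
  blocks-adjacent false false = refl

-- Sorting Fin m by a predicate

record Partition (P : Fin m → Bool) : Set where
  field
    trues falses : ℕ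
    iso          : Fin m ↔ (Fin trues ⊎ Fin falses)
    isLeft-iso   : ∀ x → isLeft (to iso x) ≡ P x

pushLeft : ∀ {a b} → (Fin 1 ⊎ (Fin a ⊎ Fin b)) ↔ (Fin (suc a) ⊎ Fin b)
pushLeft = ↔-trans (↔-sym (⊎-assoc _ _ _ _)) (⊎-cong (↔-sym +↔⊎) ↔-refl)

pushRight : ∀ {a b} → (Fin 1 ⊎ (Fin a ⊎ Fin b)) ↔ (Fin a ⊎ Fin (suc b))
pushRight = ↔-trans (↔-sym (⊎-assoc _ _ _ _))
  (↔-trans (⊎-cong (⊎-comm _ _) ↔-refl) (↔-trans (⊎-assoc _ _ _ _) (⊎-cong ↔-refl (↔-sym +↔⊎))))

isLeft-pushLeft : ∀ {a b} (s : Fin a ⊎ Fin b) → isLeft (to pushLeft (inj₂ s)) ≡ isLeft s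
isLeft-pushLeft (inj₁ _) = refl
isLeft-pushLeft (inj₂ _) = refl

isLeft-pushRight : ∀ {a b} (s : Fin a ⊎ Fin b) → isLeft (to pushRight (inj₂ s)) ≡ isLeft s
isLeft-pushRight (inj₁ _) = refl
isLeft-pushRight (inj₂ _) = refl

partition : (P : Fin m → Bool) → Partition P
partition {zero}  P = record { trues = 0 ; falses = 0 ; iso = +↔⊎ ; isLeft-iso = λ () }
partition {suc m} P with partition (P ∘ suc) | P zero in P₀
... | record { trues = a ; falses = b ; iso = f ; isLeft-iso = f-isLeft } | true = record
  { trues      = suc a
  ; falses     = b
  ; iso        = ↔-trans (+↔⊎ {1}) (↔-trans (⊎-cong ↔-refl f) pushLeft)
  ; isLeft-iso = λ { zero → sym P₀ ; (suc x) → trans (isLeft-pushLeft (to f x)) (f-isLeft x) }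
  }
... | record { trues = a ; falses = b ; iso = f ; isLeft-iso = f-isLeft } | false = record
  { trues      = a
  ; falses     = suc b
  ; iso        = ↔-trans (+↔⊎ {1}) (↔-trans (⊎-cong ↔-refl f) pushRight)
  ; isLeft-iso = λ { zero → sym P₀ ; (suc x) → trans (isLeft-pushRight (to f x)) (f-isLeft x) }
  }

oddTriangles-isoTo : ∀ G {m} {E : Fin m → Fin m → Bool} → IsoTo G E → OddTriangles E → OddTriangles (adj G)
oddTriangles-isoTo G {E = E} (f , adj≡E) odd x y z x≢y x≢z y≢z = begin
  triangleParity (adj G) x y z
    ≡⟨ cong₂ _xor_ (adj≡E x y) (cong₂ _xor_ (adj≡E y z) (adj≡E x z)) ⟩
  triangleParity E (to f x) (to f y) (to f z)
    ≡⟨ odd _ _ _ (x≢y ∘ to-injective f) (x≢z ∘ to-injective f) (y≢z ∘ to-injective f) ⟩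
  true ∎

twoCliques-isoTo : ∀ G {m} {E : Fin m → Fin m → Bool} {P Q} (f : Fin (n G) ↔ Fin m) →
                   (∀ y → E y y ≡ false) → TwoCliquesBy (adj G) P → TwoCliquesBy E Q →
                   (∀ x → Q (to f x) ≡ P x) → IsoTo G E
twoCliques-isoTo G {E = E} {P} {Q} f E-irrefl twoCliques-G twoCliques-E Q∘f≡P = f , adj≡E
  where
  adj≡E : ∀ x y → adj G x y ≡ E (to f x) (to f y)
  adj≡E x y with x ≟ y
  ... | yes refl = trans (irrefl G x) (sym (E-irrefl (to f x)))
  ... | no x≢y   = begin
    adj G x y                         ≡⟨ twoCliques-G x y x≢y ⟩
    not (P x xor P y)                 ≡⟨ cong₂ (λ p q → not (p xor q)) (Q∘f≡P x) (Q∘f≡P y) ⟨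
    not (Q (to f x) xor Q (to f y))   ≡⟨ twoCliques-E _ _ (x≢y ∘ to-injective f) ⟨
    E (to f x) (to f y)               ∎

IsoToListedBlowup : Graph → Set
IsoToListedBlowup G =
  (Σ ℕ λ a → a ≥ 1 × IsoToBlowup G (a ∷ []))
  ⊎ (Σ ℕ λ a → Σ ℕ λ b → a ≥ 1 × b ≥ 1 × IsoToBlowup G (a ∷ 0 ∷ b ∷ []))
  ⊎ IsoToBlowup G (1 ∷ 1 ∷ 1 ∷ [])
  ⊎ IsoToBlowup G (1 ∷ 0 ∷ 1 ∷ 0 ∷ 1 ∷ [])

isLeft⇒nonempty : ∀ {a} {B : Set} (s : Fin a ⊎ B) → isLeft s ≡ true → a ≥ 1
isLeft⇒nonempty {suc _} (inj₁ _) _ = s≤s z≤n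

isLeft-map : ∀ {A B C D : Set} {f : A → C} {g : B → D} (s : A ⊎ B) → isLeft (map f g s) ≡ isLeft s
isLeft-map (inj₁ _) = refl
isLeft-map (inj₂ _) = refl

twoCliques⇒listed : ∀ G {P} (z : Fin (n G)) → P z ≡ true → TwoCliquesBy (adj G) P → IsoToListedBlowup G
twoCliques⇒listed G {P} z Pz twoCliques with partition P
... | record { trues = a ; falses = zero ; iso = f ; isLeft-iso = f-isLeft } =
  inj₁ (a , isLeft⇒nonempty (to f z) (trans (f-isLeft z) Pz)
       , twoCliques-isoTo G {Q = const true} (↔-trans f (↔-sym +↔⊎)) (blowupAdj-irrefl (a ∷ []))
                          twoCliques (blowup-clique a) all-true)
  where
  all-true : ∀ x → true ≡ P x
  all-true x with to f x | f-isLeft x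
  ... | inj₁ _ | eq = eq
... | record { trues = a ; falses = suc b ; iso = f ; isLeft-iso = f-isLeft } =
  inj₂ (inj₁ (a , suc b , isLeft⇒nonempty (to f z) (trans (f-isLeft z) Pz) , s≤s z≤n
             , twoCliques-isoTo G {Q = isLeft ∘ splitAt a} g (blowupAdj-irrefl (a ∷ 0 ∷ suc b ∷ []))
                                twoCliques (blowup-twoCliques a (suc b)) side))
  where
  g : Fin (n G) ↔ Fin (a + (suc b + 0))
  g = ↔-trans f (↔-trans (⊎-cong ↔-refl (cast-id (sym (+-identityʳ (suc b))))) (↔-sym +↔⊎))

  side : ∀ x → isLeft (splitAt a (to g x)) ≡ P x
  side x = begin
    isLeft (splitAt a (to g x))  ≡⟨ cong isLeft (splitAt-join a (suc b + 0) _) ⟩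
    isLeft (map _ _ (to f x))    ≡⟨ isLeft-map (to f x) ⟩
    isLeft (to f x)              ≡⟨ f-isLeft x ⟩
    P x                          ∎

-- Graphs on at most three vertices

adj₃-≗ : {E F : Fin 3 → Fin 3 → Bool} → (∀ x y → E x y ≡ E y x) → (∀ x y → F x y ≡ F y x) →
         (∀ x → E x x ≡ false) → (∀ x → F x x ≡ false) →
         E 0F 1F ≡ F 0F 1F → E 0F 2F ≡ F 0F 2F → E 1F 2F ≡ F 1F 2F → ∀ x y → E x y ≡ F x y
adj₃-≗ {E} {F} E-sym F-sym E-irrefl F-irrefl e₀₁ e₀₂ e₁₂ = agree
  where
  diagonal : ∀ x → E x x ≡ F x x
  diagonal x = trans (E-irrefl x) (sym (F-irrefl x))

  flipped : ∀ {x y} → E x y ≡ F x y → E y x ≡ F y x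
  flipped {x} {y} e = trans (E-sym y x) (trans e (F-sym x y))

  agree : ∀ x y → E x y ≡ F x y
  agree 0F 0F = diagonal 0F
  agree 0F 1F = e₀₁
  agree 0F 2F = e₀₂
  agree 1F 0F = flipped e₀₁
  agree 1F 1F = diagonal 1F
  agree 1F 2F = e₁₂
  agree 2F 0F = flipped e₀₂
  agree 2F 1F = flipped e₁₂
  agree 2F 2F = diagonal 2F

module _ {E : Fin 3 → Fin 3 → Bool} (E-sym : ∀ x y → E x y ≡ E y x) (E-irrefl : ∀ x → E x x ≡ false) where

  private
    G₃ : Graph
    G₃ = record { n = 3 ; adj = E ; sym = E-sym ; irrefl = E-irrefl }

  isoToBlowup₃ : ∀ as (π : Fin 3 ↔ Fin (sum as)) →
                 E 0F 1F ≡ blowupAdj as (to π 0F) (to π 1F) → E 0F 2F ≡ blowupAdj as (to π 0F) (to π 2F) →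
                 E 1F 2F ≡ blowupAdj as (to π 1F) (to π 2F) → IsoToBlowup G₃ as
  isoToBlowup₃ as π e₀₁ e₀₂ e₁₂ = π , adj₃-≗ E-sym (λ x y → blowupAdj-sym as (to π x) (to π y))
                                           E-irrefl (λ x → blowupAdj-irrefl as (to π x)) e₀₁ e₀₂ e₁₂

  private
    path : IsoToBlowup G₃ (1 ∷ 1 ∷ 1 ∷ []) → IsoToListedBlowup G₃
    path = inj₂ ∘ inj₂ ∘ inj₁

    edgeAndVertex : IsoToBlowup G₃ (2 ∷ 0 ∷ 1 ∷ []) → IsoToListedBlowup G₃
    edgeAndVertex iso = inj₂ (inj₁ (2 , 1 , s≤s z≤n , s≤s z≤n , iso))

  -- π moves the middle vertex of a path into the middle block, an isolated vertex into the last one.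
  listed₃ : IsoToListedBlowup G₃
  listed₃ with E 0F 1F in e₀₁ | E 0F 2F in e₀₂ | E 1F 2F in e₁₂
  ... | true  | true  | true  = inj₁ (3 , s≤s z≤n , isoToBlowup₃ (3 ∷ []) Permutation.id e₀₁ e₀₂ e₁₂)
  ... | true  | true  | false = path (isoToBlowup₃ (1 ∷ 1 ∷ 1 ∷ []) (transpose 0F 1F) e₀₁ e₀₂ e₁₂)
  ... | true  | false | true  = path (isoToBlowup₃ (1 ∷ 1 ∷ 1 ∷ []) Permutation.id e₀₁ e₀₂ e₁₂)
  ... | false | true  | true  = path (isoToBlowup₃ (1 ∷ 1 ∷ 1 ∷ []) (transpose 1F 2F) e₀₁ e₀₂ e₁₂)
  ... | true  | false | false = edgeAndVertex (isoToBlowup₃ (2 ∷ 0 ∷ 1 ∷ []) Permutation.id e₀₁ e₀₂ e₁₂)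
  ... | false | true  | false = edgeAndVertex (isoToBlowup₃ (2 ∷ 0 ∷ 1 ∷ []) (transpose 1F 2F) e₀₁ e₀₂ e₁₂)
  ... | false | false | true  = edgeAndVertex (isoToBlowup₃ (2 ∷ 0 ∷ 1 ∷ []) (transpose 0F 2F) e₀₁ e₀₂ e₁₂)
  ... | false | false | false = inj₂ (inj₂ (inj₂ (isoToBlowup₃ (1 ∷ 0 ∷ 1 ∷ 0 ∷ 1 ∷ []) Permutation.id e₀₁ e₀₂ e₁₂)))

fewVertices⇒inClass : ∀ G → n G ≤ 3 → InLowerC4DiamondFreeSwitchingClass G
fewVertices⇒inClass G n≤3 A =
  (λ (_ , _ , _ , _ , ds , _) → four-distinct ds) , (λ (_ , _ , _ , _ , ds , _) → four-distinct ds)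
  where
  four-distinct : ∀ {a b c d : Fin (n G)} → Distinct4 a b c d → ⊥
  four-distinct ds = 1+n≰n (≤-trans (injective⇒≤ (distinct₄-injective ds)) n≤3)

isoTo-twoCliques⇒inClass : ∀ G {m} {E : Fin m → Fin m → Bool} {side} →
                           IsoTo G E → TwoCliquesBy E side → InLowerC4DiamondFreeSwitchingClass G
isoTo-twoCliques⇒inClass G {E = E} {side} iso twoCliques =
  oddTriangles⇒inClass G (oddTriangles-isoTo G {E = E} iso (twoCliques⇒oddTriangles {side = side} twoCliques))

listed⇒inClass : ∀ G → IsoToListedBlowup G → InLowerC4DiamondFreeSwitchingClass G
listed⇒inClass G (inj₁ (a , _ , iso)) =
  isoTo-twoCliques⇒inClass G {E = blowupAdj (a ∷ [])} {const true} iso (blowup-clique a)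
listed⇒inClass G (inj₂ (inj₁ (a , b , _ , _ , iso))) =
  isoTo-twoCliques⇒inClass G {E = blowupAdj (a ∷ 0 ∷ b ∷ [])} {isLeft ∘ splitAt a} iso (blowup-twoCliques a b)
listed⇒inClass G (inj₂ (inj₂ (inj₁ (f , _)))) = fewVertices⇒inClass G (injective⇒≤ (to-injective f))
listed⇒inClass G (inj₂ (inj₂ (inj₂ (f , _)))) = fewVertices⇒inClass G (injective⇒≤ (to-injective f))

inClass⇒listed : ∀ G → 0 < n G → InLowerC4DiamondFreeSwitchingClass G → IsoToListedBlowup G
inClass⇒listed G@record { n = m ; sym = E-sym ; irrefl = E-irrefl } 0<m inClass with m ≟ℕ 3
... | yes refl = listed₃ E-sym E-irrefl
... | no  m≢3  = twoCliques⇒listed G {closedNeighbourhood G z} z (closedNeighbourhood-self G z)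
                   (oddTriangles⇒twoCliques G (inClass⇒oddTriangles G m≢3 inClass) z)
  where
  z : Fin m
  z = fromℕ< 0<m

mainTheorem15 : (G : Graph) → 0 < n G →
    InLowerC4DiamondFreeSwitchingClass G ⇔
      ((Σ ℕ λ a → a ≥ 1 × IsoToBlowup G (a ∷ []))
       ⊎ (Σ ℕ λ a → Σ ℕ λ b → a ≥ 1 × b ≥ 1 × IsoToBlowup G (a ∷ 0 ∷ b ∷ []))
       ⊎ IsoToBlowup G (1 ∷ 1 ∷ 1 ∷ [])
       ⊎ IsoToBlowup G (1 ∷ 0 ∷ 1 ∷ 0 ∷ 1 ∷ []))
mainTheorem15 G 0<n = mk⇔ (inClass⇒listed G 0<n) (listed⇒inClass G)
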